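{- The system $\mathbf{K4}^{\nabla\bullet}$ is sound with respect to the class of transitive frames: every theorem of $\mathbf{K4}^{\nabla\bullet}$ is true at every state of every model based on a transitive frame.
   Context: Fix a nonempty set $\mathbf{P}$ of propositional variables. $\mathcal{L}(\nabla,\bullet)$: $\varphi::=p\mid\neg\varphi\mid\varphi\land\varphi\mid\nabla\varphi\mid\bullet\varphi$ ($p\in\mathbf{P}$), with $\Delta\varphi:=\neg\nabla\varphi$, $\circ\varphi:=\neg\bullet\varphi$. A frame is $\langle S,R\rangle$ with $S$ nonempty and $R\subseteq S\times S$; a model adds $V:\mathbf{P}\to\mathcal{P}(S)$. Truth: $\mathcal{M},s\vDash p$ iff $s\in V(p)$; Booleans as usual; $\mathcal{M},s\vDash\nabla\varphi$ iff there are $t,u$ with $sRt$, $sRu$, $\mathcal{M},t\vDash\varphi$, $\mathcal{M},u\nvDash\varphi$; $\mathcal{M},s\vDash\bullet\varphi$ iff $\mathcal{M},s\vDash\varphi$ and some $t$ with $sRt$ has $\mathcal{M},t\nvDash\varphi$. The system $\mathbf{K}^{\nabla\bullet}$ has axioms: A0 all propositional tautologies; A1 $\bullet\varphi\to\varphi$; A2 $\nabla\varphi\leftrightarrow\nabla\neg\varphi$; A3 $\bullet(\psi\to\varphi)\land\varphi\to\bullet\varphi$; A4 $\nabla(\varphi\land\psi)\to\nabla\varphi\vee\nabla\psi$; A5 $\bullet(\varphi\land\psi)\to\bullet\varphi\vee\bullet\psi$; A6 $\nabla\varphi\to\bullet\varphi\vee\bullet\neg\varphi$; A7 $\bullet(\varphi\to\psi)\land\bullet(\neg\varphi\to\chi)\to\nabla\varphi$;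 rules: from $\varphi$ infer $\Delta\varphi$; from $\varphi$ infer $\circ\varphi$; from $\varphi\leftrightarrow\psi$ infer $\Delta\varphi\leftrightarrow\Delta\psi$ and $\circ\varphi\leftrightarrow\circ\psi$; modus ponens. $\mathbf{K4}^{\nabla\bullet}$ extends $\mathbf{K}^{\nabla\bullet}$ with the axiom schemas: A4-1 $\Delta\varphi\to\Delta\Delta\varphi$; A4-2 $\Delta\varphi\to\circ(\psi\to\Delta\varphi)$; A4-3 $\bullet\psi_1\land\Delta\varphi\land\circ(\neg\psi_1\to\varphi)\to\Delta\circ(\neg\psi_2\to\varphi)$; A4-4 $\bullet\psi_1\land\Delta\varphi\land\circ(\neg\psi_1\to\varphi)\to\circ(\neg\psi_1\to\circ(\neg\psi_2\to\varphi))$. -}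

module Defs where

open import Data.Nat using (ℕ)
open import Data.Bool using (Bool; true; false; not; _∧_)
open import Data.Product using (Σ; _×_; _,_; ∃-syntax)
open import Data.Empty using (⊥)
open import Relation.Nullary using (¬_)
open import Relation.Binary.PropositionalEquality using (_≡_)

data Form (P : Set) : Set where
  var  : P → Form P
  ¬'_  : Form P → Form P
  _∧'_ : Form P → Form P → Form P
  ∇_   : Form P → Form P
  •_   : Form P → Form P

infixr 6 _∧'_
infix 8 ¬'_ ∇_ •_

module _ {P : Set} where
  Δ_ : Form P → Form P
  Δ φ = ¬' (∇ φ)

  ∘_ : Form P → Form P
  ∘ φ = ¬' (• φ)

  _∨'_ : Form P → Form P → Form P
  φ ∨' ψ = ¬' (¬' φ ∧' ¬' ψ)

  _→'_ : Form P → Form P → Form P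
  φ →' ψ = ¬' (φ ∧' ¬' ψ)

  _↔'_ : Form P → Form P → Form P
  φ ↔' ψ = (φ →' ψ) ∧' (ψ →' φ)

  infix 8 Δ_ ∘_
  infixr 5 _∨'_
  infixr 4 _→'_
  infix 3 _↔'_

data PForm : Set where
  pvar  : ℕ → PForm
  pneg  : PForm → PForm
  pand  : PForm → PForm → PForm

evalB : (ℕ → Bool) → PForm → Bool
evalB v (pvar n)   = v n
evalB v (pneg τ)   = not (evalB v τ)
evalB v (pand τ σ) = evalB v τ ∧ evalB v σ

IsTautologyP : PForm → Set
IsTautologyP τ = (v : ℕ → Bool) → evalB v τ ≡ true

subst' : {P : Set} → (ℕ → Form P) → PForm → Form P
subst' σ (pvar n)   = σ n
subst' σ (pneg τ)   = ¬' subst' σ τ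
subst' σ (pand τ ρ) = subst' σ τ ∧' subst' σ ρ

IsTautology : {P : Set} → Form P → Set
IsTautology {P} φ = Σ PForm λ τ → IsTautologyP τ × Σ (ℕ → Form P) λ σ → subst' σ τ ≡ φ

data K4⊢ {P : Set} : Form P → Set where
  A0   : ∀ {φ} → IsTautology φ → K4⊢ φ
  A1   : ∀ φ → K4⊢ (• φ →' φ)
  A2   : ∀ φ → K4⊢ (∇ φ ↔' ∇ (¬' φ))
  A3   : ∀ φ ψ → K4⊢ ((• (ψ →' φ) ∧' φ) →' • φ)
  A4   : ∀ φ ψ → K4⊢ (∇ (φ ∧' ψ) →' (∇ φ ∨' ∇ ψ))
  A5   : ∀ φ ψ → K4⊢ (• (φ ∧' ψ) →' (• φ ∨' • ψ))
  A6   : ∀ φ → K4⊢ (∇ φ →' (• φ ∨' • (¬' φ)))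
  A7   : ∀ φ ψ χ → K4⊢ ((• (φ →' ψ) ∧' • (¬' φ →' χ)) →' ∇ φ)
  A4-1 : ∀ φ → K4⊢ (Δ φ →' Δ (Δ φ))
  A4-2 : ∀ φ ψ → K4⊢ (Δ φ →' ∘ (ψ →' Δ φ))
  A4-3 : ∀ φ ψ₁ ψ₂ →
         K4⊢ ((• ψ₁ ∧' Δ φ ∧' ∘ (¬' ψ₁ →' φ)) →' Δ (∘ (¬' ψ₂ →' φ)))
  A4-4 : ∀ φ ψ₁ ψ₂ →
         K4⊢ ((• ψ₁ ∧' Δ φ ∧' ∘ (¬' ψ₁ →' φ)) →' ∘ (¬' ψ₁ →' ∘ (¬' ψ₂ →' φ)))
  R-Δ  : ∀ {φ} → K4⊢ φ → K4⊢ (Δ φ)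
  R-∘  : ∀ {φ} → K4⊢ φ → K4⊢ (∘ φ)
  RE-Δ : ∀ {φ ψ} → K4⊢ (φ ↔' ψ) → K4⊢ (Δ φ ↔' Δ ψ)
  RE-∘ : ∀ {φ ψ} → K4⊢ (φ ↔' ψ) → K4⊢ (∘ φ ↔' ∘ ψ)
  MP   : ∀ {φ ψ} → K4⊢ (φ →' ψ) → K4⊢ φ → K4⊢ ψ

record Frame : Set₁ where
  field
    S : Set
    R : S → S → Set
    s₀ : S            -- S is nonempty

record Model (P : Set) : Set₁ where
  field
    frame : Frame
  open Frame frame public
  field
    V : P → S → Set

Transitive : Frame → Set
Transitive F = ∀ {s t u} → R s t → R t u → R s u
  where open Frame F

_,_⊨_ : {P : Set} (M : Model P) → Model.S M → Form P → Set
M , s ⊨ var p    = Model.V M p s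
M , s ⊨ (¬' φ)   = ¬ (M , s ⊨ φ)
M , s ⊨ (φ ∧' ψ) = (M , s ⊨ φ) × (M , s ⊨ ψ)
M , s ⊨ (∇ φ)    = Σ (Model.S M) λ t → Σ (Model.S M) λ u →
                     Model.R M s t × Model.R M s u × (M , t ⊨ φ) × ¬ (M , u ⊨ φ)
M , s ⊨ (• φ)    = (M , s ⊨ φ) × Σ (Model.S M) λ t → Model.R M s t × ¬ (M , t ⊨ φ)

infix 2 _,_⊨_

module Submission where

open import Defs
open import Axiom.ExcludedMiddle using (ExcludedMiddle)
open import Axiom.DoubleNegationElimination using (em⇒dne)
open import Level using (zero)
open import Data.Nat using (ℕ)
open import Data.Bool using (Bool)
open import Data.Product using (_×_; _,_; proj₁; proj₂)
open import Data.Empty using (⊥-elim)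
open import Function using (_∘′_; const)
open import Relation.Nullary using (¬_; yes; no; does; proof)
open import Relation.Nullary.Reflects using (Reflects; invert; ¬-reflects; _×-reflects_)
open import Relation.Binary.PropositionalEquality using (refl; subst)

-- A formula true
-- at all successors of s makes both its ∘ and its Δ true at s, and
-- conversely ∘χ ∧ χ makes χ true at all successors. Transitivity pushes such
-- facts one step further: Δφ persists along R, and the antecedent of A4-3 and
-- A4-4 forces φ at every successor, hence at every successor of a successor.

module Classical (em : ExcludedMiddle Level.zero) {P : Set} (M : Model P) where
  open Model M

  _⊨_ : S → Form P → Set
  s ⊨ φ = _,_⊨_ M s φ

  infix 2 _⊨_

  □ : S → Form P → Set
  □ s φ = ∀ {t} → R s t → t ⊨ φ

  Valid : Form P → Set
  Valid φ = ∀ s → s ⊨ φ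

  dne : {A : Set} → ¬ ¬ A → A
  dne = em⇒dne em

  →-intro : {A B : Set} → (A → B) → ¬ (A × ¬ B)
  →-intro f (a , ¬b) = ¬b (f a)

  →-elim : {A B : Set} → ¬ (A × ¬ B) → A → B
  →-elim h a = dne (λ ¬b → h (a , ¬b))

  ∨-introˡ : {A B : Set} → A → ¬ (¬ A × ¬ B)
  ∨-introˡ a (¬a , _) = ¬a a

  ∨-introʳ : {A B : Set} → B → ¬ (¬ A × ¬ B)
  ∨-introʳ b (_ , ¬b) = ¬b b

  □⇒∘ : ∀ {s} φ → □ s φ → s ⊨ ∘ φ
  □⇒∘ φ all (_ , t , st , ¬φt) = ¬φt (all st)

  ∘⇒□ : ∀ {s} φ → s ⊨ ∘ φ → s ⊨ φ → □ s φ
  ∘⇒□ φ ∘φ φs {t} st = dne (λ ¬φt → ∘φ (φs , t , st , ¬φt))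

  □⇒Δ : ∀ {s} φ → □ s φ → s ⊨ Δ φ
  □⇒Δ φ all (_ , u , _ , su , _ , ¬φu) = ¬φu (all su)

  □⇒∘→ : ∀ {s} φ ψ → □ s φ → s ⊨ ∘ (ψ →' φ)
  □⇒∘→ φ ψ all = □⇒∘ (ψ →' φ) (→-intro ∘′ const ∘′ all)

  ∇-transfer : ∀ {s} φ ψ → Valid (φ ↔' ψ) → s ⊨ ∇ φ → s ⊨ ∇ ψ
  ∇-transfer φ ψ eq (t , u , st , su , φt , ¬φu) =
    t , u , st , su , →-elim (proj₁ (eq t)) φt , ¬φu ∘′ →-elim (proj₂ (eq u))

  •-transfer : ∀ {s} φ ψ → Valid (φ ↔' ψ) → s ⊨ • φ → s ⊨ • ψ
  •-transfer {s} φ ψ eq (φs , t , st , ¬φt) =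
    →-elim (proj₁ (eq s)) φs , t , st , ¬φt ∘′ →-elim (proj₂ (eq t))

  ↔-sym : ∀ φ ψ → Valid (φ ↔' ψ) → Valid (ψ ↔' φ)
  ↔-sym φ ψ eq s = proj₂ (eq s) , proj₁ (eq s)

  Δ-cong : ∀ φ ψ → Valid (φ ↔' ψ) → Valid (Δ φ ↔' Δ ψ)
  Δ-cong φ ψ eq s = →-intro (λ Δφ → Δφ ∘′ ∇-transfer ψ φ (↔-sym φ ψ eq))
                  , →-intro (λ Δψ → Δψ ∘′ ∇-transfer φ ψ eq)

  ∘-cong : ∀ φ ψ → Valid (φ ↔' ψ) → Valid (∘ φ ↔' ∘ ψ)
  ∘-cong φ ψ eq s = →-intro (λ ∘φ → ∘φ ∘′ •-transfer ψ φ (↔-sym φ ψ eq))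
                  , →-intro (λ ∘ψ → ∘ψ ∘′ •-transfer φ ψ eq)

  module _ (σ : ℕ → Form P) (s : S) where
    truthValuation : ℕ → Bool
    truthValuation n = does (em {s ⊨ σ n})

    substitution-reflects : ∀ τ → Reflects (s ⊨ subst' σ τ) (evalB truthValuation τ)
    substitution-reflects (pvar n)   = proof (em {s ⊨ σ n})
    substitution-reflects (pneg τ)   = ¬-reflects (substitution-reflects τ)
    substitution-reflects (pand τ ρ) = substitution-reflects τ ×-reflects substitution-reflects ρ

  tautology-valid : ∀ {φ} → IsTautology φ → Valid φ
  tautology-valid (τ , taut , σ , refl) s =
    invert (subst (Reflects _) (taut (truthValuation σ s)) (substitution-reflects σ s τ))

  ∇-¬ : ∀ {s} φ → s ⊨ ∇ φ → s ⊨ ∇ (¬' φ)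
  ∇-¬ φ (t , u , st , su , φt , ¬φu) = u , t , su , st , ¬φu , (λ ¬φt → ¬φt φt)

  ∇-¬⁻¹ : ∀ {s} φ → s ⊨ ∇ (¬' φ) → s ⊨ ∇ φ
  ∇-¬⁻¹ φ (t , u , st , su , ¬φt , ¬¬φu) = u , t , su , st , dne ¬¬φu , ¬φt

  •-→ : ∀ {s} φ ψ → s ⊨ • (ψ →' φ) → s ⊨ φ → s ⊨ • φ
  •-→ φ ψ (_ , t , st , ¬imp) φs = φs , t , st , ¬imp ∘′ →-intro ∘′ const

  ∇-∧ : ∀ {s} φ ψ → s ⊨ ∇ (φ ∧' ψ) → s ⊨ ∇ φ ∨' ∇ ψ
  ∇-∧ φ ψ (t , u , st , su , (φt , ψt) , ¬φψu) with em {u ⊨ φ}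
  ... | yes φu = ∨-introʳ (t , u , st , su , ψt , ¬φψu ∘′ (φu ,_))
  ... | no ¬φu = ∨-introˡ (t , u , st , su , φt , ¬φu)

  •-∧ : ∀ {s} φ ψ → s ⊨ • (φ ∧' ψ) → s ⊨ • φ ∨' • ψ
  •-∧ φ ψ ((φs , ψs) , t , st , ¬φψt) with em {t ⊨ φ}
  ... | yes φt = ∨-introʳ (ψs , t , st , ¬φψt ∘′ (φt ,_))
  ... | no ¬φt = ∨-introˡ (φs , t , st , ¬φt)

  ∇⇒•∨•¬ : ∀ {s} φ → s ⊨ ∇ φ → s ⊨ • φ ∨' • (¬' φ)
  ∇⇒•∨•¬ {s} φ (t , u , st , su , φt , ¬φu) with em {s ⊨ φ}
  ... | yes φs = ∨-introˡ (φs , u , su , ¬φu)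
  ... | no ¬φs = ∨-introʳ (¬φs , t , st , (λ ¬φt → ¬φt φt))

  •→∧•¬→⇒∇ : ∀ {s} φ ψ χ → s ⊨ • (φ →' ψ) → s ⊨ • (¬' φ →' χ) → s ⊨ ∇ φ
  •→∧•¬→⇒∇ φ ψ χ (_ , t , st , ¬imp₁) (_ , u , su , ¬imp₂) =
      t , u , st , su
    , dne (λ ¬φt → ¬imp₁ (→-intro (⊥-elim ∘′ ¬φt)))
    , (λ φu → ¬imp₂ (→-intro (λ ¬φu → ⊥-elim (¬φu φu))))

module OnTransitiveFrames (em : ExcludedMiddle Level.zero) {P : Set} (M : Model P)
                          (trans : Transitive (Model.frame M)) where
  open Model M
  open Classical em M

  □-trans : ∀ {s t} φ → □ s φ → R s t → □ t φ
  □-trans φ all st tu = all (trans st tu)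

  □⇒□∘→ : ∀ {s} φ ψ → □ s φ → □ s (∘ (ψ →' φ))
  □⇒□∘→ φ ψ all st = □⇒∘→ φ ψ (□-trans φ all st)

  Δ-persistent : ∀ {s} φ → s ⊨ Δ φ → □ s (Δ φ)
  Δ-persistent φ Δφ st (u , v , tu , tv , φu , ¬φv) =
    Δφ (u , v , trans st tu , trans st tv , φu , ¬φv)

  -- •ψ₁ yields a successor t₀ refuting ψ₁, where ∘(¬ψ₁ → φ) forces φ;
  -- Δφ then spreads φ from t₀ to every successor.
  •Δ∘⇒□ : ∀ {s} φ ψ₁ → s ⊨ • ψ₁ ∧' Δ φ ∧' ∘ (¬' ψ₁ →' φ) → □ s φ
  •Δ∘⇒□ φ ψ₁ ((ψ₁s , t₀ , st₀ , ¬ψ₁t₀) , Δφ , ∘imp) {t} st =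
    dne (λ ¬φt → Δφ (t₀ , t , st₀ , st , φt₀ , ¬φt))
    where
      φt₀ : t₀ ⊨ φ
      φt₀ = →-elim (∘⇒□ (¬' ψ₁ →' φ) ∘imp (→-intro (λ ¬ψ₁s → ⊥-elim (¬ψ₁s ψ₁s))) st₀) ¬ψ₁t₀

  sound : ∀ {φ} → K4⊢ φ → Valid φ
  sound (A0 taut)          = tautology-valid taut
  sound (A1 φ) s           = →-intro proj₁
  sound (A2 φ) s           = →-intro (∇-¬ φ) , →-intro (∇-¬⁻¹ φ)
  sound (A3 φ ψ) s         = →-intro (λ (•imp , φs) → •-→ φ ψ •imp φs)
  sound (A4 φ ψ) s         = →-intro (∇-∧ φ ψ)
  sound (A5 φ ψ) s         = →-intro (•-∧ φ ψ)
  sound (A6 φ) s           = →-intro (∇⇒•∨•¬ φ)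
  sound (A7 φ ψ χ) s       = →-intro (λ (•imp₁ , •imp₂) → •→∧•¬→⇒∇ φ ψ χ •imp₁ •imp₂)
  sound (A4-1 φ) s         = →-intro (□⇒Δ (Δ φ) ∘′ Δ-persistent φ)
  sound (A4-2 φ ψ) s       = →-intro (□⇒∘→ (Δ φ) ψ ∘′ Δ-persistent φ)
  sound (A4-3 φ ψ₁ ψ₂) s   =
    →-intro (□⇒Δ (∘ (¬' ψ₂ →' φ)) ∘′ □⇒□∘→ φ (¬' ψ₂) ∘′ •Δ∘⇒□ φ ψ₁)
  sound (A4-4 φ ψ₁ ψ₂) s   =
    →-intro (□⇒∘→ (∘ (¬' ψ₂ →' φ)) (¬' ψ₁) ∘′ □⇒□∘→ φ (¬' ψ₂) ∘′ •Δ∘⇒□ φ ψ₁)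
  sound (R-Δ {φ} d) s      = □⇒Δ φ (λ {t} _ → sound d t)
  sound (R-∘ {φ} d) s      = □⇒∘ φ (λ {t} _ → sound d t)
  sound (RE-Δ {φ} {ψ} d)   = Δ-cong φ ψ (sound d)
  sound (RE-∘ {φ} {ψ} d)   = ∘-cong φ ψ (sound d)
  sound (MP d e) s         = →-elim (sound d s) (sound e s)

mainTheorem11 : ExcludedMiddle Level.zero → (P : Set) → P →
    (φ : Form P) → K4⊢ φ →
    (M : Model P) → Transitive (Model.frame M) →
    (s : Model.S M) → M , s ⊨ φ
mainTheorem11 em P _ φ d M trans = OnTransitiveFrames.sound em M trans d
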